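{- Let $m\ge1$ be an integer and let $s_n$ be defined by $s_n=\delta_{n,0}+s_{n-m-1}+s_{n-m-2}$ for $n\ge0$ and $s_n=0$ for $n<0$. Then for all $n\ge0$, \[ s_n^2=\delta_{n,0}+s_{n-m-1}^2+s_{n-m-2}^2+2\sum_{l=2m+3}^nP_{l-2m-3}^{\{ -2,m-1,m\}}s_{n-l}^2. \]
   Context: $\delta_{i,j}$ is $1$ if $i=j$ and $0$ otherwise; empty sums are $0$. For a finite set $W$ of integers, $P_n^W$ is the number of permutations $\pi$ of $\{1,\ldots,n\}$ with $\pi(i)-i\in W$ for all $i$ (equivalently, the permanent of the $n\times n$ $(0,1)$ matrix whose $(i,j)$ entry is $1$ iff $j-i\in W$), with $P_0^W=1$. -}

module Defs where

open import Data.Nat using (ℕ; zero; suc; _+_; _∸_; _≟_)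
open import Data.Integer using (ℤ; +_; _-_)
open import Data.Fin using (Fin; toℕ)
import Data.Fin as Fin
open import Data.List using (List; []; _∷_; map; concatMap; length; filter; upTo; allFin)
open import Data.Nat.ListAction using (sum)
open import Data.Vec using (Vec; []; _∷_; lookup; toList)
open import Data.List.Relation.Unary.Unique.Propositional using (Unique)
open import Data.List.Relation.Unary.AllPairs using (allPairs?)
open import Data.Vec.Relation.Unary.All using (All; all?)
open import Data.Vec using (tabulate)
open import Data.List.Membership.DecPropositional (Data.Integer._≟_) using (_∈_; _∈?_)
open import Data.Product using (_×_)
open import Relation.Nullary using (¬?)
open import Relation.Nullary.Decidable using (_×-dec_)
open import Relation.Unary using (Decidable)

δ : ℕ → ℕ → ℕ
δ i j with i ≟ j
... | Relation.Nullary.yes _ = 1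
... | Relation.Nullary.no  _ = 0

Σ[_to_] : ℕ → ℕ → (ℕ → ℕ) → ℕ
Σ[ a to b ] f = sum (map (λ i → f (a + i)) (upTo (suc b ∸ a)))

allVecs : (n k : ℕ) → List (Vec (Fin n) k)
allVecs n zero    = [] ∷ []
allVecs n (suc k) = concatMap (λ v → map (_∷ v) (allFin n)) (allVecs n k)

-- a vector v : Vec (Fin n) n encodes the map i ↦ lookup v i on {0,…,n-1}
-- (0-indexed; the shift π(i) - i is index-independent).
-- It is a permutation iff its entries are pairwise distinct.
IsPerm : ∀ {n} → Vec (Fin n) n → Set
IsPerm v = Unique (toList v)

Respects : ∀ {n} → List ℤ → Vec (Fin n) n → Set
Respects {n} W v = All (λ i → ((+ toℕ (lookup v i)) - (+ toℕ i)) ∈ W) (tabulate (λ i → i))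

isPerm? : ∀ {n} → Decidable (IsPerm {n})
isPerm? v = allPairs? (λ x y → ¬? (x Fin.≟ y)) (toList v)

respects? : ∀ {n} (W : List ℤ) → Decidable (Respects {n} W)
respects? {n} W v = all? (λ i → ((+ toℕ (lookup v i)) - (+ toℕ i)) ∈? W) (tabulate (λ i → i))

P : ℕ → List ℤ → ℕ
P n W = length (filter (λ v → isPerm? v ×-dec respects? W v) (allVecs n n))

{-# OPTIONS --safe #-}
-- Squaring the recurrence gives s_n² = δ_{n,0} + a² + b² + 2ab with a = s_{n-m-1}, b = s_{n-m-2}
-- (the cross terms with δ_{n,0} vanish), so everything rests on a product formula for ab.
-- Expanding, by the recurrence, the factor of larger index in a product s_{N-p} s_{N-q} of two
-- distinct terms, and repeating until the indices meet, writes it as a sum of squares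
-- s_{N-k-m-2}² weighted by the number pathPairs m k p q of expansion histories, plus boundary
-- terms. These numbers obey the transfer recursion that builds a permutation with displacements
-- in {-2, m-1, m} row by row: before each row such a permutation has used every value more than
-- two below it and exactly two others, whose positions relative to the row form the state (p, q).
-- Hence P_k = pathPairs m k 0 1, which turns the product formula into the stated identity.
module Submission where

module Lemmas where

  open import Defs
  open import Data.Nat using (ℕ; zero; suc; _+_; _*_; _^_; _∸_; _≤_; _<_; z≤n; s≤s; _≟_; _<?_; pred)
  import Data.Nat.Properties as ℕ
  open import Data.Nat.ListAction using (sum)
  open import Data.Nat.ListAction.Properties using (sum-++)
  open import Data.Nat.Solver using (module +-*-Solver)
  open +-*-Solver using (solve; _:+_; _:*_; _:=_; con)
  open import Data.Integer using (ℤ; +_; -[1+_]; _-_; _⊖_)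
  import Data.Integer as ℤ
  import Data.Integer.Properties as ℤ
  open import Data.Fin using (Fin; toℕ)
  import Data.Fin as Fin
  import Data.Fin.Properties as Fin
  open import Data.List using (List; []; _∷_; map; concatMap; length; filter; upTo; applyUpTo; allFin; tabulate; _++_)
  import Data.List.Properties as List
  open import Data.List.Relation.Unary.All as All using (All; []; _∷_)
  open import Data.List.Relation.Unary.Any using (here; there)
  open import Data.List.Relation.Unary.All.Properties using (¬Any⇒All¬)
  open import Data.List.Relation.Unary.AllPairs using ([]; _∷_)
  open import Data.List.Relation.Unary.Unique.Propositional using (Unique)
  open import Data.List.Membership.Propositional using (_∈_; _∉_)
  open import Data.List.Membership.DecPropositional ℕ._≟_ using (_∈?_)
  open import Data.Vec using (Vec; []; _∷_; lookup; toList)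
  import Data.Vec.Properties as Vec
  import Data.Vec.Relation.Unary.All.Properties as VecAll
  open import Data.Bool using (true; false)
  open import Data.Empty using (⊥-elim)
  open import Data.Unit using (⊤; tt)
  open import Data.Sum using (_⊎_; inj₁; inj₂; [_,_]′; swap)
  open import Data.Product using (_×_; _,_)
  open import Function using (_∘_; _⇔_; mk⇔; Equivalence)
  open import Relation.Binary.PropositionalEquality
  open import Relation.Binary.Definitions using (tri<; tri≈; tri>)
  open import Relation.Nullary using (Dec; yes; no; _because_; ¬_; ¬?)
  open import Relation.Nullary.Decidable using (_×-dec_; _⊎-dec_)
  open import Relation.Unary using (Decidable)

  𝟙 : ∀ {A : Set} → Dec A → ℕ
  𝟙 (true because _) = 1
  𝟙 (false because _) = 0

  𝟙-yes : ∀ {A : Set} (d : Dec A) → A → 𝟙 d ≡ 1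
  𝟙-yes (yes _) _ = refl
  𝟙-yes (no ¬a) a = ⊥-elim (¬a a)

  𝟙-no : ∀ {A : Set} (d : Dec A) → ¬ A → 𝟙 d ≡ 0
  𝟙-no (yes a) ¬a = ⊥-elim (¬a a)
  𝟙-no (no _) _ = refl

  𝟙-⇔ : ∀ {A B : Set} (d : Dec A) (e : Dec B) → (A → B) → (B → A) → 𝟙 d ≡ 𝟙 e
  𝟙-⇔ (yes a) (yes b) f g = refl
  𝟙-⇔ (yes a) (no ¬b) f g = ⊥-elim (¬b (f a))
  𝟙-⇔ (no ¬a) (yes b) f g = ⊥-elim (¬a (g b))
  𝟙-⇔ (no _) (no _) f g = refl

  𝟙-× : ∀ {A B : Set} (d : Dec A) (e : Dec B) → 𝟙 (d ×-dec e) ≡ 𝟙 d * 𝟙 e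
  𝟙-× (yes a) (yes b) = refl
  𝟙-× (yes a) (no _) = refl
  𝟙-× (no _) (yes b) = refl
  𝟙-× (no _) (no _) = refl

  𝟙-⊎ : ∀ {A B : Set} (d : Dec A) (e : Dec B) → (A → ¬ B) → 𝟙 (d ⊎-dec e) ≡ 𝟙 d + 𝟙 e
  𝟙-⊎ (yes a) (yes b) ex = ⊥-elim (ex a b)
  𝟙-⊎ (yes a) (no _) ex = refl
  𝟙-⊎ (no _) (yes b) ex = refl
  𝟙-⊎ (no _) (no _) ex = refl

  sum< : ℕ → (ℕ → ℕ) → ℕ
  sum< zero f = 0
  sum< (suc n) f = f 0 + sum< n (f ∘ suc)

  sum<-cong : ∀ n {f g : ℕ → ℕ} → (∀ i → i < n → f i ≡ g i) → sum< n f ≡ sum< n g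
  sum<-cong zero e = refl
  sum<-cong (suc n) e = cong₂ _+_ (e 0 (s≤s z≤n)) (sum<-cong n (λ i i<n → e (suc i) (s≤s i<n)))

  sum<-zero : ∀ n {f : ℕ → ℕ} → (∀ i → i < n → f i ≡ 0) → sum< n f ≡ 0
  sum<-zero zero e = refl
  sum<-zero (suc n) e = cong₂ _+_ (e 0 (s≤s z≤n)) (sum<-zero n (λ i i<n → e (suc i) (s≤s i<n)))

  sum<-+ : ∀ n (f g : ℕ → ℕ) → sum< n (λ i → f i + g i) ≡ sum< n f + sum< n g
  sum<-+ zero f g = refl
  sum<-+ (suc n) f g rewrite sum<-+ n (f ∘ suc) (g ∘ suc) =
    solve 4 (λ a b c d → (a :+ b) :+ (c :+ d) := (a :+ c) :+ (b :+ d)) refl (f 0) (g 0) _ _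

  sum<-*ˡ : ∀ n c (f : ℕ → ℕ) → sum< n (λ i → c * f i) ≡ c * sum< n f
  sum<-*ˡ zero c f = sym (ℕ.*-zeroʳ c)
  sum<-*ˡ (suc n) c f rewrite sum<-*ˡ n c (f ∘ suc) = sym (ℕ.*-distribˡ-+ c (f 0) _)

  sum<-split : ∀ a b (f : ℕ → ℕ) → sum< (a + b) f ≡ sum< a f + sum< b (λ i → f (a + i))
  sum<-split zero b f = refl
  sum<-split (suc a) b f rewrite sum<-split a b (f ∘ suc) = sym (ℕ.+-assoc (f 0) _ _)

  sum<-vanishing-tail : ∀ a b (f : ℕ → ℕ) → (∀ i → a ≤ i → f i ≡ 0) → sum< (a + b) f ≡ sum< a f
  sum<-vanishing-tail a b f tail = begin
    sum< (a + b) f                               ≡⟨ sum<-split a b f ⟩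
    sum< a f + sum< b (λ i → f (a + i))          ≡⟨ cong (_+_ (sum< a f)) (sum<-zero b (λ i _ → tail (a + i) (ℕ.m≤m+n a i))) ⟩
    sum< a f + 0                                 ≡⟨ ℕ.+-identityʳ _ ⟩
    sum< a f                                     ∎
    where open ≡-Reasoning

  sum<-indicator : ∀ n a (h : ℕ → ℕ) → sum< n (λ i → 𝟙 (i ≟ a) * h i) ≡ 𝟙 (a <? n) * h a
  sum<-indicator zero a h = refl
  sum<-indicator (suc n) zero h
    rewrite sum<-zero n {λ i → 𝟙 (suc i ≟ 0) * h (suc i)} (λ _ _ → refl) = ℕ.+-identityʳ _
  sum<-indicator (suc n) (suc a) h = trans
    (sum<-cong n (λ i _ → cong (_* h (suc i)) (𝟙-⇔ (suc i ≟ suc a) (i ≟ a) ℕ.suc-injective (cong suc))))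
    (trans (sum<-indicator n a (h ∘ suc)) (cong (_* h (suc a)) (𝟙-⇔ (a <? n) (suc a <? suc n) s≤s ℕ.≤-pred)))

  sum-applyUpTo : ∀ n (f : ℕ → ℕ) → sum (applyUpTo f n) ≡ sum< n f
  sum-applyUpTo zero f = refl
  sum-applyUpTo (suc n) f = cong (_+_ (f 0)) (sum-applyUpTo n (f ∘ suc))

  sum-tabulate : ∀ n (f : ℕ → ℕ) → sum (tabulate {n = n} (f ∘ toℕ)) ≡ sum< n f
  sum-tabulate zero f = refl
  sum-tabulate (suc n) f = cong (_+_ (f 0)) (sum-tabulate n (f ∘ suc))

  sum-allFin : ∀ n (f : ℕ → ℕ) → sum (map (f ∘ toℕ) (allFin n)) ≡ sum< n f
  sum-allFin n f = trans (cong sum (List.map-tabulate {n = n} (λ i → i) (f ∘ toℕ))) (sum-tabulate n f)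

  length-filter≡sum-𝟙 : ∀ {A : Set} {P : A → Set} (P? : Decidable P) xs →
    length (filter P? xs) ≡ sum (map (𝟙 ∘ P?) xs)
  length-filter≡sum-𝟙 P? [] = refl
  length-filter≡sum-𝟙 P? (x ∷ xs) with P? x
  ... | yes _ = cong suc (length-filter≡sum-𝟙 P? xs)
  ... | no _ = length-filter≡sum-𝟙 P? xs

  sum-map-cong : ∀ {A : Set} {f g : A → ℕ} → (∀ x → f x ≡ g x) → ∀ xs → sum (map f xs) ≡ sum (map g xs)
  sum-map-cong f≗g xs = cong sum (List.map-cong f≗g xs)

  sum-map-*ˡ : ∀ {A : Set} c (f : A → ℕ) xs → sum (map (λ x → c * f x) xs) ≡ c * sum (map f xs)
  sum-map-*ˡ c f [] = sym (ℕ.*-zeroʳ c)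
  sum-map-*ˡ c f (x ∷ xs) = trans (cong (_+_ (c * f x)) (sum-map-*ˡ c f xs)) (sym (ℕ.*-distribˡ-+ c (f x) _))

  sum-map-concatMap : ∀ {A B : Set} (f : B → ℕ) (g : A → List B) xs →
    sum (map f (concatMap g xs)) ≡ sum (map (λ x → sum (map f (g x))) xs)
  sum-map-concatMap f g [] = refl
  sum-map-concatMap f g (x ∷ xs) = begin
    sum (map f (g x ++ concatMap g xs))          ≡⟨ cong sum (List.map-++ f (g x) (concatMap g xs)) ⟩
    sum (map f (g x) ++ map f (concatMap g xs))  ≡⟨ sum-++ (map f (g x)) _ ⟩
    sum (map f (g x)) + sum (map f (concatMap g xs))  ≡⟨ cong (_+_ (sum (map f (g x)))) (sum-map-concatMap f g xs) ⟩
    sum (map f (g x)) + sum (map (λ y → sum (map f (g y))) xs) ∎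
    where open ≡-Reasoning

  sum-map-comm : ∀ {A B : Set} (F : A → B → ℕ) (xs : List A) (ys : List B) →
    sum (map (λ y → sum (map (λ x → F x y) xs)) ys) ≡ sum (map (λ x → sum (map (F x) ys)) xs)
  sum-map-comm F [] ys = sum-zero ys
    where sum-zero : ∀ {B : Set} (ys : List B) → sum (map (λ _ → 0) ys) ≡ 0
          sum-zero [] = refl
          sum-zero (_ ∷ ys) = sum-zero ys
  sum-map-comm F (x ∷ xs) ys = trans (sum-map-+ ys) (cong (_+_ (sum (map (F x) ys))) (sum-map-comm F xs ys))
    where sum-map-+ : ∀ ys → sum (map (λ y → F x y + sum (map (λ x′ → F x′ y) xs)) ys)
                           ≡ sum (map (F x) ys) + sum (map (λ y → sum (map (λ x′ → F x′ y) xs)) ys)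
          sum-map-+ [] = refl
          sum-map-+ (y ∷ ys) rewrite sum-map-+ ys =
            solve 4 (λ a b c d → (a :+ b) :+ (c :+ d) := (a :+ c) :+ (b :+ d)) refl (F x y) _ _ _

  punch : ℕ → ℕ → ℕ
  punch x y with y <? x
  ... | yes _ = y
  ... | no _ = pred y

  punch-injective : ∀ {x y z} → x ≢ y → x ≢ z → punch x y ≡ punch x z → y ≡ z
  punch-injective {x} {y} {z} x≢y x≢z eq with y <? x | z <? x
  ... | yes _ | yes _ = eq
  ... | yes y<x | no z≮x =
    ⊥-elim (ℕ.<-irrefl refl (ℕ.≤-trans y<x (subst (x ≤_) (sym eq) (ℕ.<⇒≤pred (ℕ.≤∧≢⇒< (ℕ.≮⇒≥ z≮x) x≢z)))))
  ... | no y≮x | yes z<x =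
    ⊥-elim (ℕ.<-irrefl refl (ℕ.≤-trans z<x (subst (x ≤_) eq (ℕ.<⇒≤pred (ℕ.≤∧≢⇒< (ℕ.≮⇒≥ y≮x) x≢y)))))
  ... | no y≮x | no z≮x with ℕ.≤∧≢⇒< (ℕ.≮⇒≥ y≮x) x≢y | ℕ.≤∧≢⇒< (ℕ.≮⇒≥ z≮x) x≢z
  ... | s≤s _ | s≤s _ = cong suc eq

  punch-< : ∀ {n x y} → x ≢ y → x < suc n → y < suc n → punch x y < n
  punch-< {n} {x} {y} x≢y x<1+n y<1+n with y <? x
  ... | yes y<x = ℕ.≤-trans y<x (ℕ.≤-pred x<1+n)
  ... | no y≮x with ℕ.≤∧≢⇒< (ℕ.≮⇒≥ y≮x) x≢y | y<1+n
  ... | s≤s _ | s≤s y≤n = y≤n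

  -- Removing x and closing the gap it leaves maps a list of distinct numbers below
  -- 1 + n avoiding x to a list of distinct numbers below n.
  unique-bounded⇒length≤ : ∀ n (xs : List ℕ) → Unique xs → All (_< n) xs → length xs ≤ n
  unique-bounded⇒length≤ n [] _ _ = z≤n
  unique-bounded⇒length≤ zero (x ∷ xs) _ (() ∷ _)
  unique-bounded⇒length≤ (suc n) (x ∷ xs) (x∉xs ∷ uxs) (x<n ∷ xs<n) =
    s≤s (subst (_≤ n) (List.length-map (punch x) xs)
      (unique-bounded⇒length≤ n (map (punch x) xs) (punched-unique xs x∉xs uxs) (punched-< xs x∉xs xs<n)))
    where
      punched-fresh : ∀ {y} ys → x ≢ y → All (x ≢_) ys → All (y ≢_) ys →
                      All (punch x y ≢_) (map (punch x) ys)
      punched-fresh [] _ _ _ = []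
      punched-fresh (z ∷ ys) x≢y (x≢z ∷ x∉ys) (y≢z ∷ y∉ys) =
        (y≢z ∘ punch-injective x≢y x≢z) ∷ punched-fresh ys x≢y x∉ys y∉ys
      punched-unique : ∀ ys → All (x ≢_) ys → Unique ys → Unique (map (punch x) ys)
      punched-unique [] _ _ = []
      punched-unique (y ∷ ys) (x≢y ∷ x∉ys) (y∉ys ∷ uys) =
        punched-fresh ys x≢y x∉ys y∉ys ∷ punched-unique ys x∉ys uys
      punched-< : ∀ ys → All (x ≢_) ys → All (_< suc n) ys → All (_< n) (map (punch x) ys)
      punched-< [] _ _ = []
      punched-< (y ∷ ys) (x≢y ∷ x∉ys) (y<n ∷ ys<n) = punch-< x≢y x<n y<n ∷ punched-< ys x∉ys ys<n

  +-+-cancel : ∀ i j k → (i ℤ.+ ℤ.- j) ℤ.+ (j ℤ.+ k) ≡ i ℤ.+ k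
  +-+-cancel i j k = begin
    (i ℤ.+ ℤ.- j) ℤ.+ (j ℤ.+ k)   ≡⟨ ℤ.+-assoc i (ℤ.- j) (j ℤ.+ k) ⟩
    i ℤ.+ (ℤ.- j ℤ.+ (j ℤ.+ k))   ≡⟨ cong (ℤ._+_ i) (sym (ℤ.+-assoc (ℤ.- j) j k)) ⟩
    i ℤ.+ ((ℤ.- j ℤ.+ j) ℤ.+ k)   ≡⟨ cong (λ z → i ℤ.+ (z ℤ.+ k)) (ℤ.+-inverseˡ j) ⟩
    i ℤ.+ (ℤ.0ℤ ℤ.+ k)            ≡⟨ cong (ℤ._+_ i) (ℤ.+-identityˡ k) ⟩
    i ℤ.+ k                       ∎
    where open ≡-Reasoning

  -≡-⇒+≡+ : ∀ a b c d → + a - + b ≡ + c - + d → a + d ≡ c + b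
  -≡-⇒+≡+ a b c d eq = ℤ.+-injective (begin
    + a ℤ.+ + d                        ≡⟨ sym (+-+-cancel (+ a) (+ b) (+ d)) ⟩
    (+ a - + b) ℤ.+ (+ b ℤ.+ + d)      ≡⟨ cong₂ ℤ._+_ eq (ℤ.+-comm (+ b) (+ d)) ⟩
    (+ c - + d) ℤ.+ (+ d ℤ.+ + b)      ≡⟨ +-+-cancel (+ c) (+ d) (+ b) ⟩
    + c ℤ.+ + b                        ∎)
    where open ≡-Reasoning

  +≡+⇒-≡- : ∀ a b c d → a + d ≡ c + b → + a - + b ≡ + c - + d
  +≡+⇒-≡- a b c d eq = begin
    + a - + b              ≡⟨ ℤ.[+m]-[+n]≡m⊖n a b ⟩
    a ⊖ b                  ≡⟨ sym (ℤ.+-cancelˡ-⊖ d a b) ⟩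
    (d + a) ⊖ (d + b)      ≡⟨ cong₂ _⊖_ (trans (ℕ.+-comm d a) (trans eq (ℕ.+-comm c b))) (ℕ.+-comm d b) ⟩
    (b + c) ⊖ (b + d)      ≡⟨ ℤ.+-cancelˡ-⊖ b c d ⟩
    c ⊖ d                  ≡⟨ sym (ℤ.[+m]-[+n]≡m⊖n c d) ⟩
    + c - + d              ∎
    where open ≡-Reasoning

  [1+m]-[1+n]≡m-n : ∀ m n → + suc m - + suc n ≡ + m - + n
  [1+m]-[1+n]≡m-n m n = begin
    + suc m - + suc n   ≡⟨ ℤ.[+m]-[+n]≡m⊖n (suc m) (suc n) ⟩
    suc m ⊖ suc n       ≡⟨ ℤ.[1+m]⊖[1+n]≡m⊖n m n ⟩
    m ⊖ n               ≡⟨ sym (ℤ.[+m]-[+n]≡m⊖n m n) ⟩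
    + m - + n           ∎
    where open ≡-Reasoning

  m<n⇒m-n<0 : ∀ {m n} → m < n → + m - + n ℤ.< + 0
  m<n⇒m-n<0 {m} {n} m<n = subst (λ k → + m - + k ℤ.< + 0) (ℕ.m+[n∸m]≡n (ℕ.<⇒≤ m<n)) (go m (n ∸ m) (ℕ.m<n⇒0<n∸m m<n))
    where
      go : ∀ m r → 0 < r → + m - + (m + r) ℤ.< + 0
      go zero (suc r) _ = ℤ.-<+
      go (suc m) r 0<r = subst (ℤ._< + 0) (sym ([1+m]-[1+n]≡m-n m (m + r))) (go m r 0<r)

  -- pathPairs m k p q is the number of ways to fill the last k rows of a permutation
  -- with displacements in {-2, m - 1, m}, when the values used by the earlier rows are
  -- those more than two below the current row together with the two values p - 2 and
  -- q - 2 places above it.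
  pathPairs : ℕ → ℕ → ℕ → ℕ → ℕ
  pathPairs m zero zero (suc zero) = 1
  pathPairs m zero (suc zero) zero = 1
  pathPairs m zero _ _ = 0
  pathPairs m (suc k) zero zero = 0
  pathPairs m (suc k) zero (suc q) =
    𝟙 (¬? (m ≟ q)) * pathPairs m k m q + 𝟙 (¬? (suc m ≟ q)) * pathPairs m k (suc m) q
  pathPairs m (suc k) (suc p) zero =
    𝟙 (¬? (m ≟ p)) * pathPairs m k p m + 𝟙 (¬? (suc m ≟ p)) * pathPairs m k p (suc m)
  pathPairs m (suc k) (suc p) (suc q) = pathPairs m k p q

  pathPairs-sym : ∀ m k p q → pathPairs m k p q ≡ pathPairs m k q p
  pathPairs-sym m zero zero zero = refl
  pathPairs-sym m zero zero (suc zero) = refl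
  pathPairs-sym m zero zero (suc (suc q)) = refl
  pathPairs-sym m zero (suc zero) zero = refl
  pathPairs-sym m zero (suc (suc p)) zero = refl
  pathPairs-sym m zero (suc zero) (suc zero) = refl
  pathPairs-sym m zero (suc zero) (suc (suc q)) = refl
  pathPairs-sym m zero (suc (suc p)) (suc zero) = refl
  pathPairs-sym m zero (suc (suc p)) (suc (suc q)) = refl
  pathPairs-sym m (suc k) zero zero = refl
  pathPairs-sym m (suc k) zero (suc q) =
    cong₂ _+_ (cong (𝟙 (¬? (m ≟ q)) *_) (pathPairs-sym m k m q)) (cong (𝟙 (¬? (suc m ≟ q)) *_) (pathPairs-sym m k (suc m) q))
  pathPairs-sym m (suc k) (suc p) zero =
    cong₂ _+_ (cong (𝟙 (¬? (m ≟ p)) *_) (pathPairs-sym m k p m)) (cong (𝟙 (¬? (suc m ≟ p)) *_) (pathPairs-sym m k p (suc m)))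
  pathPairs-sym m (suc k) (suc p) (suc q) = pathPairs-sym m k p q

  pathPairs-far : ∀ m k p q → suc (suc k) ≤ p → pathPairs m k p q ≡ 0
  pathPairs-far m zero (suc zero) q (s≤s ())
  pathPairs-far m zero (suc (suc p)) zero _ = refl
  pathPairs-far m zero (suc (suc p)) (suc q) _ = refl
  pathPairs-far m (suc k) (suc p) zero (s≤s 2+k≤p)
    rewrite pathPairs-far m k p m 2+k≤p | pathPairs-far m k p (suc m) 2+k≤p =
    cong₂ _+_ (ℕ.*-zeroʳ (𝟙 (¬? (m ≟ p)))) (ℕ.*-zeroʳ (𝟙 (¬? (suc m ≟ p))))
  pathPairs-far m (suc k) (suc p) (suc q) (s≤s 2+k≤p) = pathPairs-far m k p q 2+k≤p

  pathPairs-late : ∀ m k p q → k < p → k < q → pathPairs m k p q ≡ 0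
  pathPairs-late m zero (suc zero) (suc q) _ _ = refl
  pathPairs-late m zero (suc (suc p)) (suc zero) _ _ = refl
  pathPairs-late m zero (suc (suc p)) (suc (suc q)) _ _ = refl
  pathPairs-late m (suc k) (suc p) (suc q) (s≤s k<p) (s≤s k<q) = pathPairs-late m k p q k<p k<q

  pathPairs-shift : ∀ m j k → pathPairs m (j + k) j (suc j) ≡ pathPairs m k 0 1
  pathPairs-shift m zero k = refl
  pathPairs-shift m (suc j) k = pathPairs-shift m j k

  pathPairs-final : ∀ m {q} → 1 ≤ q → pathPairs m 0 0 (suc q) ≡ 0
  pathPairs-final m (s≤s z≤n) = refl

  -- t N p stands for s_{N-p}.
  module ProductFormula (m : ℕ) (1≤m : 1 ≤ m) (t : ℕ → ℕ → ℕ)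
    (t-shift : ∀ N p → t (suc N) (suc p) ≡ t N p)
    (t-future : ∀ N p → N < p → t N p ≡ 0)
    (t-start : t 0 0 ≡ 1)
    (t-rec : ∀ N → t (suc N) 0 ≡ t (suc N) (suc m) + t (suc N) (suc (suc m)))
    where

    t-∸ : ∀ {N p} → p ≤ N → t N p ≡ t (N ∸ p) 0
    t-∸ {N} {zero} _ = refl
    t-∸ {suc N} {suc p} (s≤s p≤N) = trans (t-shift N p) (t-∸ p≤N)

    t-early : ∀ {d} → 1 ≤ d → d ≤ m → t d 0 ≡ 0
    t-early {suc d} _ d≤m = begin
      t (suc d) 0                                   ≡⟨ t-rec d ⟩
      t (suc d) (suc m) + t (suc d) (suc (suc m))   ≡⟨ cong₂ _+_ (t-future _ _ (s≤s d≤m)) (t-future _ _ (s≤s (ℕ.m≤n⇒m≤1+n d≤m))) ⟩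
      0                                             ∎
      where open ≡-Reasoning

    t-diagonal : ∀ N → t N N ≡ 1
    t-diagonal N = trans (t-∸ (ℕ.≤-refl {N})) (trans (cong (λ d → t d 0) (ℕ.n∸n≡0 N)) t-start)

    t-1+m : t (suc m) 0 ≡ 1
    t-1+m = trans (t-rec m) (cong₂ _+_ (t-diagonal (suc m)) (t-future _ _ ℕ.≤-refl))

    t-2+m : t (suc (suc m)) 0 ≡ 1
    t-2+m = begin
      t (suc (suc m)) 0                                   ≡⟨ t-rec (suc m) ⟩
      t (suc (suc m)) (suc m) + t (suc (suc m)) (suc (suc m))
                                                          ≡⟨ cong₂ _+_ (trans (t-∸ (ℕ.n≤1+n (suc m))) (cong (λ d → t d 0) (ℕ.m+n∸n≡m 1 (suc m))))
                                                                       (t-diagonal (suc (suc m))) ⟩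
      t 1 0 + 1                                           ≡⟨ cong (_+ 1) (t-early ℕ.≤-refl 1≤m) ⟩
      1                                                   ∎
      where open ≡-Reasoning

    t-step : ∀ N → t (suc N) 0 ≡ t N m + t N (suc m)
    t-step N = trans (t-rec N) (cong₂ _+_ (t-shift N m) (t-shift N (suc m)))

    t-gap : ∀ {N p} → p < N → N ≤ p + m → t N p ≡ 0
    t-gap {N} {p} p<N N≤p+m = trans (t-∸ (ℕ.<⇒≤ p<N)) (t-early (ℕ.m<n⇒0<n∸m p<N) (ℕ.m≤n+o⇒m∸n≤o N p N≤p+m))

    pathSum : ℕ → ℕ → ℕ → ℕ → ℕ
    pathSum B N p q = sum< B (λ k → pathPairs m k p q * t N (k + suc (suc m)) ^ 2)

    boundary : ℕ → ℕ → ℕ → ℕ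
    boundary N p q = t q p * t N q ^ 2 + t p q * t N p ^ 2

    Expansion : ℕ → ℕ → ℕ → ℕ → Set
    Expansion N B p q = t N p * t N q ≡ pathSum B N p q + boundary N p q

    pathSum-sym : ∀ B N p q → pathSum B N p q ≡ pathSum B N q p
    pathSum-sym B N p q = sum<-cong B (λ k _ → cong (_* t N (k + suc (suc m)) ^ 2) (pathPairs-sym m k p q))

    boundary-sym : ∀ N p q → boundary N p q ≡ boundary N q p
    boundary-sym N p q = ℕ.+-comm (t q p * t N q ^ 2) _

    pathSum-shift : ∀ B N p q → pathSum (suc B) (suc N) (suc p) (suc q) ≡ pathSum B N p q
    pathSum-shift B N p q = cong₂ _+_
      (cong (_* t (suc N) (suc (suc m)) ^ 2) (pathPairs-late m 0 (suc p) (suc q) (s≤s z≤n) (s≤s z≤n)))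
      (sum<-cong B (λ k _ → cong (λ x → pathPairs m k p q * x ^ 2) (t-shift N (k + suc (suc m)))))

    boundary-shift : ∀ N p q → boundary (suc N) (suc p) (suc q) ≡ boundary N p q
    boundary-shift N p q rewrite t-shift q p | t-shift p q | t-shift N q | t-shift N p = refl

    pathSum-at-0 : ∀ B p q → pathSum B 0 p q ≡ 0
    pathSum-at-0 B p q = sum<-zero B (λ k _ → trans
      (cong (λ x → pathPairs m k p q * x ^ 2) (t-future 0 (k + suc (suc m)) (ℕ.<-≤-trans (s≤s z≤n) (ℕ.m≤n+m (suc (suc m)) k))))
      (ℕ.*-zeroʳ (pathPairs m k p q)))

    expansion-start : ∀ B p q → p ≢ q → Expansion 0 B p q
    expansion-start B zero zero p≢q = ⊥-elim (p≢q refl)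
    expansion-start B zero (suc q) _ rewrite t-future 0 (suc q) (s≤s z≤n) | pathSum-at-0 B 0 (suc q) =
      solve 2 (λ x y → x :* con 0 := con 0 :+ (y :* con 0 :+ con 0)) refl (t 0 0) (t (suc q) 0)
    expansion-start B (suc p) zero _ rewrite t-future 0 (suc p) (s≤s z≤n) | pathSum-at-0 B (suc p) 0 =
      sym (ℕ.*-zeroʳ (t (suc p) 0))
    expansion-start B (suc p) (suc q) _
      rewrite t-future 0 (suc p) (s≤s z≤n) | t-future 0 (suc q) (s≤s z≤n) | pathSum-at-0 B (suc p) (suc q) =
      solve 2 (λ x y → con 0 := con 0 :+ (x :* con 0 :+ y :* con 0)) refl (t (suc q) (suc p)) (t (suc p) (suc q))

    rest : ℕ → ℕ → ℕ → ℕ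
    rest N r q = 𝟙 (¬? (r ≟ q)) * boundary N r q + 𝟙 (r ≟ q) * t N q ^ 2

    rest-≢ : ∀ {N r q} → r ≢ q → rest N r q ≡ boundary N r q
    rest-≢ {N} {r} {q} r≢q with r ≟ q
    ... | yes r≡q = ⊥-elim (r≢q r≡q)
    ... | no _ = trans (ℕ.+-identityʳ _) (ℕ.+-identityʳ _)

    rest-≡ : ∀ N q → rest N q q ≡ t N q ^ 2
    rest-≡ N q with q ≟ q
    ... | yes _ = ℕ.+-identityʳ _
    ... | no q≢q = ⊥-elim (q≢q refl)

    product-split : ∀ N B r q → (∀ p q → p ≢ q → Expansion N B p q) →
                    t N r * t N q ≡ 𝟙 (¬? (r ≟ q)) * pathSum B N r q + rest N r q
    product-split N B r q expansion with r ≟ q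
    ... | yes refl = sym (trans (ℕ.+-identityʳ _) (cong (t N r *_) (ℕ.*-identityʳ _)))
    ... | no r≢q = trans (expansion r q r≢q) (sym (cong₂ _+_ (ℕ.+-identityʳ (pathSum B N r q))
      (trans (ℕ.+-identityʳ (1 * boundary N r q)) (ℕ.+-identityʳ (boundary N r q)))))

    rest-recurrence-0 : ∀ N → rest N m 0 + rest N (suc m) 0
                               ≡ pathPairs m 0 0 1 * t N (suc m) ^ 2 + t 1 0 * t N 0 ^ 2
    rest-recurrence-0 N
      rewrite rest-≢ {N} (ℕ.>⇒≢ 1≤m) | rest-≢ {N} {suc m} {0} (λ ())
            | t-future 0 m 1≤m | t-early 1≤m ℕ.≤-refl | t-future 0 (suc m) (s≤s z≤n) | t-1+m | t-early ℕ.≤-refl 1≤m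
      = sym (ℕ.+-identityʳ _)

    rest-recurrence-below : ∀ N {q} → 1 ≤ q → q < m → rest N m q + rest N (suc m) q
                                     ≡ pathPairs m 0 0 (suc q) * t N (suc m) ^ 2 + t (suc q) 0 * t N q ^ 2
    rest-recurrence-below N {q} 1≤q q<m
      rewrite rest-≢ {N} (ℕ.>⇒≢ q<m) | rest-≢ {N} (ℕ.>⇒≢ (ℕ.m<n⇒m<1+n q<m))
            | t-future q m q<m | t-gap q<m (ℕ.m≤n+m m q)
            | t-future q (suc m) (ℕ.m<n⇒m<1+n q<m) | t-gap (ℕ.m<n⇒m<1+n q<m) (ℕ.+-monoˡ-≤ m 1≤q)
            | pathPairs-final m 1≤q | t-gap (s≤s z≤n) q<m
      = refl

    rest-recurrence-m : ∀ N → rest N m m + rest N (suc m) m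
                               ≡ pathPairs m 0 0 (suc m) * t N (suc m) ^ 2 + t (suc m) 0 * t N m ^ 2
    rest-recurrence-m N
      rewrite rest-≡ N m | rest-≢ {N} {suc m} {m} (ℕ.>⇒≢ ℕ.≤-refl)
            | t-future m (suc m) ℕ.≤-refl | t-gap (ℕ.n<1+n m) (ℕ.+-monoˡ-≤ m 1≤m)
            | pathPairs-final m 1≤m | t-1+m
      = refl

    rest-recurrence-1+m : ∀ N → rest N m (suc m) + rest N (suc m) (suc m)
                                 ≡ pathPairs m 0 0 (suc (suc m)) * t N (suc m) ^ 2 + t (suc (suc m)) 0 * t N (suc m) ^ 2
    rest-recurrence-1+m N
      rewrite rest-≢ {N} {m} {suc m} (ℕ.<⇒≢ ℕ.≤-refl) | rest-≡ N (suc m)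
            | t-gap (ℕ.n<1+n m) (ℕ.+-monoˡ-≤ m 1≤m) | t-future m (suc m) ℕ.≤-refl | t-2+m
      = sym (ℕ.+-identityʳ _)

    rest-recurrence-above : ∀ N {q} → suc m < q → rest N m q + rest N (suc m) q
                                     ≡ pathPairs m 0 0 (suc q) * t N (suc m) ^ 2 + t (suc q) 0 * t N q ^ 2
    rest-recurrence-above N {q} 1+m<q
      rewrite rest-≢ {N} (ℕ.<⇒≢ (ℕ.<-trans (ℕ.n<1+n m) 1+m<q)) | rest-≢ {N} (ℕ.<⇒≢ 1+m<q)
            | t-future m q (ℕ.<-trans (ℕ.n<1+n m) 1+m<q) | t-future (suc m) q 1+m<q
            | pathPairs-final m (ℕ.<-trans (s≤s z≤n) 1+m<q) | t-step q
      = begin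
        (t q m * t N q ^ 2 + 0) + (t q (suc m) * t N q ^ 2 + 0)
          ≡⟨ cong₂ _+_ (ℕ.+-identityʳ (t q m * t N q ^ 2)) (ℕ.+-identityʳ (t q (suc m) * t N q ^ 2)) ⟩
        t q m * t N q ^ 2 + t q (suc m) * t N q ^ 2
          ≡⟨ sym (ℕ.*-distribʳ-+ (t N q ^ 2) (t q m) _) ⟩
        (t q m + t q (suc m)) * t N q ^ 2
          ∎
      where open ≡-Reasoning

    rest-recurrence : ∀ N q → rest N m q + rest N (suc m) q
                              ≡ pathPairs m 0 0 (suc q) * t N (suc m) ^ 2 + t (suc q) 0 * t N q ^ 2
    rest-recurrence N zero = rest-recurrence-0 N
    rest-recurrence N (suc q) with ℕ.<-cmp (suc q) m
    ... | tri< q<m _ _ = rest-recurrence-below N (s≤s z≤n) q<m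
    ... | tri≈ _ refl _ = rest-recurrence-m N
    ... | tri> _ _ m<q with suc q ≟ suc m
    ...   | yes refl = rest-recurrence-1+m N
    ...   | no q≢1+m = rest-recurrence-above N (ℕ.≤∧≢⇒< m<q (≢-sym q≢1+m))

    pathSum-step : ∀ B N q → pathSum (suc B) (suc N) 0 (suc q)
                   ≡ pathPairs m 0 0 (suc q) * t N (suc m) ^ 2
                     + (𝟙 (¬? (m ≟ q)) * pathSum B N m q + 𝟙 (¬? (suc m ≟ q)) * pathSum B N (suc m) q)
    pathSum-step B N q = cong₂ _+_ (cong (λ x → pathPairs m 0 0 (suc q) * x ^ 2) (t-shift N (suc m))) (begin
        sum< B (λ k → (a * pathPairs m k m q + b * pathPairs m k (suc m) q) * t (suc N) (suc (k + X)) ^ 2)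
      ≡⟨ sum<-cong B (λ k _ → distribute k) ⟩
        sum< B (λ k → a * (pathPairs m k m q * t N (k + X) ^ 2) + b * (pathPairs m k (suc m) q * t N (k + X) ^ 2))
      ≡⟨ sum<-+ B _ _ ⟩
        sum< B (λ k → a * (pathPairs m k m q * t N (k + X) ^ 2)) + sum< B (λ k → b * (pathPairs m k (suc m) q * t N (k + X) ^ 2))
      ≡⟨ cong₂ _+_ (sum<-*ˡ B a _) (sum<-*ˡ B b _) ⟩
        a * pathSum B N m q + b * pathSum B N (suc m) q
      ∎)
      where
        open ≡-Reasoning
        X a b : ℕ
        X = suc (suc m)
        a = 𝟙 (¬? (m ≟ q))
        b = 𝟙 (¬? (suc m ≟ q))
        distribute : ∀ k → (a * pathPairs m k m q + b * pathPairs m k (suc m) q) * t (suc N) (suc (k + X)) ^ 2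
                           ≡ a * (pathPairs m k m q * t N (k + X) ^ 2) + b * (pathPairs m k (suc m) q * t N (k + X) ^ 2)
        distribute k rewrite t-shift N (k + X) =
          solve 5 (λ a x b y z → (a :* x :+ b :* y) :* z := a :* (x :* z) :+ b :* (y :* z)) refl
            a (pathPairs m k m q) b (pathPairs m k (suc m) q) (t N (k + X) ^ 2)

    boundary-step : ∀ N q → boundary (suc N) 0 (suc q) ≡ t (suc q) 0 * t N q ^ 2
    boundary-step N q rewrite t-shift N q | t-future 0 (suc q) (s≤s z≤n) = ℕ.+-identityʳ _

    expansion-step : ∀ N B → (∀ p q → p ≢ q → Expansion N B p q) → ∀ q → Expansion (suc N) (suc B) 0 (suc q)
    expansion-step N B expansion q = begin
        t (suc N) 0 * t (suc N) (suc q)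
      ≡⟨ cong₂ _*_ (t-step N) (t-shift N q) ⟩
        (t N m + t N (suc m)) * t N q
      ≡⟨ ℕ.*-distribʳ-+ (t N q) (t N m) _ ⟩
        t N m * t N q + t N (suc m) * t N q
      ≡⟨ cong₂ _+_ (product-split N B m q expansion) (product-split N B (suc m) q expansion) ⟩
        (a * pathSum B N m q + rest N m q) + (b * pathSum B N (suc m) q + rest N (suc m) q)
      ≡⟨ solve 4 (λ x y z w → (x :+ y) :+ (z :+ w) := (x :+ z) :+ (y :+ w)) refl
           (a * pathSum B N m q) (rest N m q) (b * pathSum B N (suc m) q) (rest N (suc m) q) ⟩
        (a * pathSum B N m q + b * pathSum B N (suc m) q) + (rest N m q + rest N (suc m) q)
      ≡⟨ cong (_+_ (a * pathSum B N m q + b * pathSum B N (suc m) q)) (rest-recurrence N q) ⟩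
        (a * pathSum B N m q + b * pathSum B N (suc m) q) + (d * t N (suc m) ^ 2 + t (suc q) 0 * t N q ^ 2)
      ≡⟨ solve 3 (λ x y z → x :+ (y :+ z) := (y :+ x) :+ z) refl
           (a * pathSum B N m q + b * pathSum B N (suc m) q) (d * t N (suc m) ^ 2) (t (suc q) 0 * t N q ^ 2) ⟩
        (d * t N (suc m) ^ 2 + (a * pathSum B N m q + b * pathSum B N (suc m) q)) + t (suc q) 0 * t N q ^ 2
      ≡⟨ sym (cong₂ _+_ (pathSum-step B N q) (boundary-step N q)) ⟩
        pathSum (suc B) (suc N) 0 (suc q) + boundary (suc N) 0 (suc q)
      ∎
      where
        open ≡-Reasoning
        a b d : ℕ
        a = 𝟙 (¬? (m ≟ q))
        b = 𝟙 (¬? (suc m ≟ q))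
        d = pathPairs m 0 0 (suc q)

    expansion : ∀ N B → N ≤ B → ∀ p q → p ≢ q → Expansion N B p q
    expansion zero B _ p q p≢q = expansion-start B p q p≢q
    expansion (suc N) (suc B) (s≤s N≤B) zero zero p≢q = ⊥-elim (p≢q refl)
    expansion (suc N) (suc B) (s≤s N≤B) zero (suc q) _ = expansion-step N B (expansion N B N≤B) q
    expansion (suc N) (suc B) (s≤s N≤B) (suc p) zero _ = begin
      t (suc N) (suc p) * t (suc N) 0                                 ≡⟨ ℕ.*-comm (t (suc N) (suc p)) _ ⟩
      t (suc N) 0 * t (suc N) (suc p)                                 ≡⟨ expansion-step N B (expansion N B N≤B) p ⟩
      pathSum (suc B) (suc N) 0 (suc p) + boundary (suc N) 0 (suc p)  ≡⟨ cong₂ _+_ (pathSum-sym (suc B) (suc N) 0 (suc p)) (boundary-sym (suc N) 0 (suc p)) ⟩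
      pathSum (suc B) (suc N) (suc p) 0 + boundary (suc N) (suc p) 0  ∎
      where open ≡-Reasoning
    expansion (suc N) (suc B) (s≤s N≤B) (suc p) (suc q) p≢q = begin
      t (suc N) (suc p) * t (suc N) (suc q)          ≡⟨ cong₂ _*_ (t-shift N p) (t-shift N q) ⟩
      t N p * t N q                                  ≡⟨ expansion N B N≤B p q (p≢q ∘ cong suc) ⟩
      pathSum B N p q + boundary N p q               ≡⟨ sym (cong₂ _+_ (pathSum-shift B N p q) (boundary-shift N p q)) ⟩
      pathSum (suc B) (suc N) (suc p) (suc q) + boundary (suc N) (suc p) (suc q) ∎
      where open ≡-Reasoning

    product-formula : ∀ N → t N (suc m) * t N (suc (suc m))
                            ≡ sum< N (λ i → pathPairs m i 0 1 * t N (2 * m + 3 + i) ^ 2)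
    product-formula N = begin
      t N (suc m) * t N (suc (suc m))
        ≡⟨ expansion N (suc m + N) (ℕ.m≤n+m N (suc m)) (suc m) (suc (suc m)) (ℕ.<⇒≢ ℕ.≤-refl) ⟩
      pathSum (suc m + N) N (suc m) (suc (suc m)) + boundary N (suc m) (suc (suc m))
        ≡⟨ cong₂ _+_ (sum<-split (suc m) N (f N)) boundary-vanishes ⟩
      (sum< (suc m) (f N) + sum< N (λ i → f N (suc m + i))) + 0
        ≡⟨ trans (ℕ.+-identityʳ _) (cong (_+ sum< N (λ i → f N (suc m + i))) (sum<-zero (suc m) (λ k k<1+m →
             cong (_* t N (k + suc (suc m)) ^ 2) (pathPairs-late m k (suc m) (suc (suc m)) k<1+m (ℕ.m<n⇒m<1+n k<1+m))))) ⟩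
      sum< N (λ i → f N (suc m + i))
        ≡⟨ sum<-cong N (λ i _ → cong₂ (λ d x → d * t N x ^ 2) (pathPairs-shift m (suc m) i)
             (solve 2 (λ m i → (con 1 :+ m :+ i) :+ (con 2 :+ m) := con 2 :* m :+ con 3 :+ i) refl m i)) ⟩
      sum< N (λ i → pathPairs m i 0 1 * t N (2 * m + 3 + i) ^ 2)
        ∎
      where
        open ≡-Reasoning
        f : ℕ → ℕ → ℕ
        f N k = pathPairs m k (suc m) (suc (suc m)) * t N (k + suc (suc m)) ^ 2
        boundary-vanishes : boundary N (suc m) (suc (suc m)) ≡ 0
        boundary-vanishes rewrite t-gap {suc (suc m)} {suc m} ℕ.≤-refl (s≤s (ℕ.+-monoˡ-≤ m 1≤m))
                                | t-future (suc m) (suc (suc m)) ℕ.≤-refl = refl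

  displacements : ℕ → List ℤ
  displacements ℓ = -[1+ 1 ] ∷ (+ suc ℓ - + 1) ∷ + suc ℓ ∷ []

  module PermutationCount (n ℓ : ℕ) where

    W : List ℤ
    W = displacements ℓ

    Allowed : ℕ → ℕ → Set
    Allowed row x = (2 + x ≡ row) ⊎ (x ≡ row + ℓ) ⊎ (x ≡ row + suc ℓ)

    allowed? : ∀ row x → Dec (Allowed row x)
    allowed? row x = (2 + x ≟ row) ⊎-dec ((x ≟ row + ℓ) ⊎-dec (x ≟ row + suc ℓ))

    ∈W⇒allowed : ∀ x i → (+ x - + i) ∈ W → Allowed i x
    ∈W⇒allowed x i (here eq) = inj₁ (trans (ℕ.+-comm 2 x) (-≡-⇒+≡+ x i 0 2 eq))
    ∈W⇒allowed x i (there (here eq)) =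
      inj₂ (inj₁ (ℕ.suc-injective (trans (ℕ.+-comm 1 x) (trans (-≡-⇒+≡+ x i (suc ℓ) 1 eq) (cong suc (ℕ.+-comm ℓ i))))))
    ∈W⇒allowed x i (there (there (here eq))) =
      inj₂ (inj₂ (trans (sym (ℕ.+-identityʳ x)) (trans (-≡-⇒+≡+ x i (suc ℓ) 0 (trans eq (sym (ℤ.+-identityʳ (+ suc ℓ))))) (ℕ.+-comm (suc ℓ) i))))

    allowed⇒∈W : ∀ x i → Allowed i x → (+ x - + i) ∈ W
    allowed⇒∈W x i (inj₁ eq) = here (+≡+⇒-≡- x i 0 2 (trans (ℕ.+-comm x 2) eq))
    allowed⇒∈W x i (inj₂ (inj₁ eq)) =
      there (here (+≡+⇒-≡- x i (suc ℓ) 1 (trans (ℕ.+-comm x 1) (cong suc (trans eq (ℕ.+-comm i ℓ))))))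
    allowed⇒∈W x i (inj₂ (inj₂ eq)) =
      there (there (here (trans (+≡+⇒-≡- x i (suc ℓ) 0 (trans (ℕ.+-identityʳ x) (trans eq (ℕ.+-comm i (suc ℓ))))) (ℤ.+-identityʳ (+ suc ℓ)))))

    AllowedFrom : ℕ → ∀ {k} → Vec (Fin n) k → Set
    AllowedFrom row {k} v = ∀ (i : Fin k) → Allowed (row + toℕ i) (toℕ (lookup v i))

    respects⇒allowedFrom : (v : Vec (Fin n) n) → Respects W v → AllowedFrom 0 v
    respects⇒allowedFrom v r i = ∈W⇒allowed _ _
      (subst (λ j → (+ toℕ (lookup v j) - + toℕ j) ∈ W) (Vec.lookup∘tabulate (λ j → j) i) (VecAll.lookup⁺ r i))

    allowedFrom⇒respects : (v : Vec (Fin n) n) → AllowedFrom 0 v → Respects W v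
    allowedFrom⇒respects v a = VecAll.lookup⁻ (λ i →
      subst (λ j → (+ toℕ (lookup v j) - + toℕ j) ∈ W) (sym (Vec.lookup∘tabulate (λ j → j) i)) (allowed⇒∈W _ _ (a i)))

    allowedFrom-∷⁻ : ∀ row {k} x (v : Vec (Fin n) k) → AllowedFrom row (x ∷ v) → Allowed row (toℕ x) × AllowedFrom (suc row) v
    allowedFrom-∷⁻ row x v a =
      subst (λ r → Allowed r (toℕ x)) (ℕ.+-identityʳ row) (a Fin.zero) ,
      λ i → subst (λ r → Allowed r (toℕ (lookup v i))) (ℕ.+-suc row (toℕ i)) (a (Fin.suc i))

    allowedFrom-∷⁺ : ∀ row {k} x (v : Vec (Fin n) k) → Allowed row (toℕ x) → AllowedFrom (suc row) v → AllowedFrom row (x ∷ v)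
    allowedFrom-∷⁺ row x v ax av Fin.zero = subst (λ r → Allowed r (toℕ x)) (sym (ℕ.+-identityʳ row)) ax
    allowedFrom-∷⁺ row x v ax av (Fin.suc i) = subst (λ r → Allowed r (toℕ (lookup v i))) (sym (ℕ.+-suc row (toℕ i))) (av i)

    Fresh : List ℕ → ℕ → ℕ → Set
    Fresh used row x = x ∉ used × Allowed row x

    fresh? : ∀ used row x → Dec (Fresh used row x)
    fresh? used row x = ¬? (x ∈? used) ×-dec allowed? row x

    Admissible : List ℕ → ℕ → ∀ {k} → Vec (Fin n) k → Set
    Admissible used row [] = ⊤
    Admissible used row (x ∷ v) = Fresh used row (toℕ x) × Admissible (toℕ x ∷ used) (suc row) v

    admissible? : ∀ used row {k} (v : Vec (Fin n) k) → Dec (Admissible used row v)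
    admissible? used row [] = yes tt
    admissible? used row (x ∷ v) = fresh? used row (toℕ x) ×-dec admissible? (toℕ x ∷ used) (suc row) v

    Avoids : List ℕ → List (Fin n) → Set
    Avoids used = All (λ y → toℕ y ∉ used)

    admissible⁺ : ∀ used row {k} (v : Vec (Fin n) k) →
                  Unique (toList v) → Avoids used (toList v) → AllowedFrom row v → Admissible used row v
    admissible⁺ used row [] _ _ _ = tt
    admissible⁺ used row (x ∷ v) (x∉v ∷ uv) (x∉used ∷ av) a =
      let (ax , a′) = allowedFrom-∷⁻ row x v a in
      (x∉used , ax) , admissible⁺ (toℕ x ∷ used) (suc row) v uv (avoids-∷ (toList v) x∉v av) a′
      where
        avoids-∷ : ∀ ys → All (x ≢_) ys → Avoids used ys → Avoids (toℕ x ∷ used) ys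
        avoids-∷ [] [] [] = []
        avoids-∷ (y ∷ ys) (x≢y ∷ x∉ys) (y∉used ∷ ys∉used) = y∉x∷used ∷ avoids-∷ ys x∉ys ys∉used
          where y∉x∷used : toℕ y ∉ toℕ x ∷ used
                y∉x∷used (here y≡x) = x≢y (Fin.toℕ-injective (sym y≡x))
                y∉x∷used (there y∈used) = y∉used y∈used

    admissible⁻ : ∀ used row {k} (v : Vec (Fin n) k) → Admissible used row v →
                  Unique (toList v) × Avoids used (toList v) × AllowedFrom row v
    admissible⁻ used row [] _ = [] , [] , (λ ())
    admissible⁻ used row (x ∷ v) ((x∉used , ax) , adm) =
      let (uv , av , a) = admissible⁻ (toℕ x ∷ used) (suc row) v adm in
      (All.map (λ y∉ x≡y → y∉ (here (cong toℕ (sym x≡y)))) av ∷ uv) ,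
      (x∉used ∷ All.map (λ y∉ → y∉ ∘ there) av) ,
      allowedFrom-∷⁺ row x v ax a

    completions : ℕ → ℕ → List ℕ → ℕ
    completions k row used = length (filter (admissible? used row) (allVecs n k))

    P≡completions : P n W ≡ completions n 0 []
    P≡completions = begin
      P n W                                                            ≡⟨ length-filter≡sum-𝟙 _ (allVecs n n) ⟩
      sum (map (𝟙 ∘ λ v → isPerm? v ×-dec respects? W v) (allVecs n n))
        ≡⟨ sum-map-cong (λ v → 𝟙-⇔ _ (admissible? [] 0 v) (to v) (from v)) (allVecs n n) ⟩
      sum (map (𝟙 ∘ admissible? [] 0) (allVecs n n))                    ≡⟨ sym (length-filter≡sum-𝟙 _ (allVecs n n)) ⟩
      completions n 0 []                                               ∎
      where
        open ≡-Reasoning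
        to : ∀ v → IsPerm v × Respects W v → Admissible [] 0 v
        to v (perm , r) = admissible⁺ [] 0 v perm (All.tabulate (λ _ ())) (respects⇒allowedFrom v r)
        from : ∀ v → Admissible [] 0 v → IsPerm v × Respects W v
        from v adm = let (perm , _ , a) = admissible⁻ [] 0 v adm in perm , allowedFrom⇒respects v a

    completions-suc : ∀ k row used →
      completions (suc k) row used ≡ sum< n (λ x → 𝟙 (fresh? used row x) * completions k (suc row) (x ∷ used))
    completions-suc k row used = begin
      completions (suc k) row used
        ≡⟨ length-filter≡sum-𝟙 (admissible? used row) (allVecs n (suc k)) ⟩
      sum (map (𝟙 ∘ admissible? used row) (concatMap (λ v → map (_∷ v) (allFin n)) (allVecs n k)))
        ≡⟨ sum-map-concatMap (𝟙 ∘ admissible? used row) (λ v → map (_∷ v) (allFin n)) (allVecs n k) ⟩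
      sum (map (λ v → sum (map (𝟙 ∘ admissible? used row) (map (_∷ v) (allFin n)))) (allVecs n k))
        ≡⟨ sum-map-cong (λ v → trans (cong sum (sym (List.map-∘ (allFin n))))
                                     (sum-map-cong (λ x → 𝟙-× (fresh? used row (toℕ x)) (admissible? (toℕ x ∷ used) (suc row) v)) (allFin n)))
                        (allVecs n k) ⟩
      sum (map (λ v → sum (map (λ x → F x v) (allFin n))) (allVecs n k))
        ≡⟨ sum-map-comm F (allFin n) (allVecs n k) ⟩
      sum (map (λ x → sum (map (F x) (allVecs n k))) (allFin n))
        ≡⟨ sum-map-cong (λ x → trans (sum-map-*ˡ (𝟙 (fresh? used row (toℕ x))) _ (allVecs n k))
                                     (cong (𝟙 (fresh? used row (toℕ x)) *_) (sym (length-filter≡sum-𝟙 _ (allVecs n k)))))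
                        (allFin n) ⟩
      sum (map (λ x → 𝟙 (fresh? used row (toℕ x)) * completions k (suc row) (toℕ x ∷ used)) (allFin n))
        ≡⟨ sum-allFin n (λ x → 𝟙 (fresh? used row x) * completions k (suc row) (x ∷ used)) ⟩
      sum< n (λ x → 𝟙 (fresh? used row x) * completions k (suc row) (x ∷ used))
        ∎
      where
        open ≡-Reasoning
        F : Fin n → Vec (Fin n) k → ℕ
        F x v = 𝟙 (fresh? used row (toℕ x)) * 𝟙 (admissible? (toℕ x ∷ used) (suc row) v)

    completionsVia : ℕ → ℕ → List ℕ → ℕ → ℕ
    completionsVia k row used x = 𝟙 (¬? (x ∈? used)) * completions k (suc row) (x ∷ used)

    choice : ℕ → ℕ → List ℕ → ℕ → ℕ
    choice k row used x = 𝟙 (x <? n) * completionsVia k row used x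

    backward : ℕ → ℕ → List ℕ → ℕ
    backward k (suc (suc r)) used = choice k (suc (suc r)) used r
    backward k _ used = 0

    𝟙-allowed : ∀ row x → 𝟙 (allowed? row x) ≡ 𝟙 (2 + x ≟ row) + (𝟙 (x ≟ row + ℓ) + 𝟙 (x ≟ row + suc ℓ))
    𝟙-allowed row x = trans (𝟙-⊎ (2 + x ≟ row) _ back≢forward)
                            (cong (_+_ (𝟙 (2 + x ≟ row))) (𝟙-⊎ (x ≟ row + ℓ) (x ≟ row + suc ℓ) ℓ≢1+ℓ))
      where
        back≢forward : 2 + x ≡ row → ¬ (x ≡ row + ℓ ⊎ x ≡ row + suc ℓ)
        back≢forward refl (inj₁ eq) = ℕ.<-irrefl eq (ℕ.<-≤-trans (ℕ.m<n+m x (s≤s z≤n)) (ℕ.m≤m+n (2 + x) ℓ))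
        back≢forward refl (inj₂ eq) = ℕ.<-irrefl eq (ℕ.<-≤-trans (ℕ.m<n+m x (s≤s z≤n)) (ℕ.m≤m+n (2 + x) (suc ℓ)))
        ℓ≢1+ℓ : x ≡ row + ℓ → x ≢ row + suc ℓ
        ℓ≢1+ℓ refl eq = ℕ.<-irrefl eq (ℕ.+-monoʳ-< row (ℕ.n<1+n ℓ))

    backward-sum : ∀ k row used → sum< n (λ x → 𝟙 (2 + x ≟ row) * completionsVia k row used x)
                                  ≡ backward k row used
    backward-sum k zero used = sum<-zero n (λ _ _ → refl)
    backward-sum k (suc zero) used = sum<-zero n (λ _ _ → refl)
    backward-sum k (suc (suc r)) used = trans
      (sum<-cong n (λ x _ → cong (_* completionsVia k (suc (suc r)) used x)
        (𝟙-⇔ (2 + x ≟ 2 + r) (x ≟ r) (ℕ.suc-injective ∘ ℕ.suc-injective) (cong (suc ∘ suc)))))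
      (sum<-indicator n r (completionsVia k (suc (suc r)) used))

    completions-choices : ∀ k row used → completions (suc k) row used
                          ≡ backward k row used + (choice k row used (row + ℓ) + choice k row used (row + suc ℓ))
    completions-choices k row used = begin
      completions (suc k) row used
        ≡⟨ completions-suc k row used ⟩
      sum< n (λ x → 𝟙 (fresh? used row x) * c x)
        ≡⟨ sum<-cong n (λ x _ → split x) ⟩
      sum< n (λ x → 𝟙 (2 + x ≟ row) * g x + (𝟙 (x ≟ row + ℓ) * g x + 𝟙 (x ≟ row + suc ℓ) * g x))
        ≡⟨ trans (sum<-+ n _ _) (cong (_+_ (sum< n (λ x → 𝟙 (2 + x ≟ row) * g x))) (sum<-+ n _ _)) ⟩
      sum< n (λ x → 𝟙 (2 + x ≟ row) * g x) + (sum< n (λ x → 𝟙 (x ≟ row + ℓ) * g x) + sum< n (λ x → 𝟙 (x ≟ row + suc ℓ) * g x))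
        ≡⟨ cong₂ _+_ (backward-sum k row used) (cong₂ _+_ (sum<-indicator n (row + ℓ) g) (sum<-indicator n (row + suc ℓ) g)) ⟩
      backward k row used + (choice k row used (row + ℓ) + choice k row used (row + suc ℓ))
        ∎
      where
        open ≡-Reasoning
        c : ℕ → ℕ
        c x = completions k (suc row) (x ∷ used)
        g : ℕ → ℕ
        g = completionsVia k row used
        split : ∀ x → 𝟙 (fresh? used row x) * c x ≡ 𝟙 (2 + x ≟ row) * g x + (𝟙 (x ≟ row + ℓ) * g x + 𝟙 (x ≟ row + suc ℓ) * g x)
        split x rewrite 𝟙-× (¬? (x ∈? used)) (allowed? row x) | 𝟙-allowed row x =
          solve 5 (λ a b f h d → (a :* (b :+ (f :+ h))) :* d := b :* (a :* d) :+ (f :* (a :* d) :+ h :* (a :* d))) refl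
            (𝟙 (¬? (x ∈? used))) (𝟙 (2 + x ≟ row)) (𝟙 (x ≟ row + ℓ)) (𝟙 (x ≟ row + suc ℓ)) (c x)

    allowed⇒row≤2+x : ∀ {row x} → Allowed row x → row ≤ 2 + x
    allowed⇒row≤2+x (inj₁ refl) = ℕ.≤-refl
    allowed⇒row≤2+x {row} (inj₂ (inj₁ refl)) = ℕ.≤-trans (ℕ.m≤m+n row ℓ) (ℕ.m≤n+m (row + ℓ) 2)
    allowed⇒row≤2+x {row} (inj₂ (inj₂ refl)) = ℕ.≤-trans (ℕ.m≤m+n row (suc ℓ)) (ℕ.m≤n+m (row + suc ℓ) 2)

    record Partial (k row : ℕ) (used : List ℕ) : Set where
      field
        rows-left : row + k ≡ n
        unique : Unique used
        bounded : All (_< n) used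
        size : length used ≡ row

    open Partial

    Partial-∷ : ∀ {k row used x} → Partial (suc k) row used → x < n → x ∉ used → Partial k (suc row) (x ∷ used)
    Partial-∷ {k} {row} {used} {x} π x<n x∉used = record
      { rows-left = trans (sym (ℕ.+-suc row k)) (rows-left π)
      ; unique = ¬Any⇒All¬ used x∉used ∷ unique π
      ; bounded = x<n ∷ bounded π
      ; size = cong suc (size π)
      }

    -- A value more than two below the current row can no longer be reached, yet every
    -- value below n must be hit: a complete filling would be n + 1 distinct values below n.
    completions-missing : ∀ {k row used j} → Partial k row used → j ∉ used → 2 + j < row → completions k row used ≡ 0
    completions-missing {zero} {row} {used} {j} π j∉used 2+j<row =
      ⊥-elim (ℕ.1+n≰n (subst (λ l → suc l ≤ n) (trans (size π) row≡n)
        (unique-bounded⇒length≤ n (j ∷ used) (¬Any⇒All¬ used j∉used ∷ unique π) (j<n ∷ bounded π))))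
      where
        row≡n : row ≡ n
        row≡n = trans (sym (ℕ.+-identityʳ row)) (rows-left π)
        j<n : j < n
        j<n = ℕ.<-trans (ℕ.m<n+m j (s≤s z≤n)) (subst (2 + j <_) row≡n 2+j<row)
    completions-missing {suc k} {row} {used} {j} π j∉used 2+j<row = trans (completions-suc k row used) (sum<-zero n vanishes)
      where
        vanishes : ∀ x → x < n → 𝟙 (fresh? used row x) * completions k (suc row) (x ∷ used) ≡ 0
        vanishes x x<n with fresh? used row x
        ... | no _ = refl
        ... | yes (x∉used , allowed) = cong (_+ 0) (completions-missing (Partial-∷ π x<n x∉used) j∉x∷used (ℕ.m<n⇒m<1+n 2+j<row))
          where
            j∉x∷used : j ∉ x ∷ used
            j∉x∷used (here refl) = ℕ.<-irrefl refl (ℕ.<-≤-trans 2+j<row (allowed⇒row≤2+x allowed))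
            j∉x∷used (there j∈used) = j∉used j∈used

    Used : ℕ → ℕ → ℕ → ℕ → Set
    Used row p q j = (2 + j < row) ⊎ (2 + j ≡ row + p) ⊎ (2 + j ≡ row + q)

    -- In the first two rows one of the two pending values p - 2 and q - 2 places above the
    -- row is fictitious (negative).
    record Reachable (k row : ℕ) (used : List ℕ) (p q : ℕ) : Set where
      field
        partial : Partial k row used
        used⇒Used : ∀ {j} → j ∈ used → Used row p q j
        Used⇒used : ∀ {j} → Used row p q j → j ∈ used
        p≢q : p ≢ q
        early-row : row < 2 → p ≡ 0 ⊎ q ≡ 0

    open Reachable

    Used-swap : ∀ {row p q j} → Used row p q j → Used row q p j
    Used-swap (inj₁ below) = inj₁ below
    Used-swap (inj₂ (inj₁ eq)) = inj₂ (inj₂ eq)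
    Used-swap (inj₂ (inj₂ eq)) = inj₂ (inj₁ eq)

    Reachable-swap : ∀ {k row used p q} → Reachable k row used p q → Reachable k row used q p
    Reachable-swap ρ = record
      { partial = partial ρ
      ; used⇒Used = Used-swap ∘ used⇒Used ρ
      ; Used⇒used = Used⇒used ρ ∘ Used-swap
      ; p≢q = p≢q ρ ∘ sym
      ; early-row = swap ∘ early-row ρ
      }

    2+[r+p]≡r+[2+p] : ∀ r p → 2 + (r + p) ≡ r + (2 + p)
    2+[r+p]≡r+[2+p] r p = sym (trans (ℕ.+-suc r (suc p)) (cong suc (ℕ.+-suc r p)))

    pending<2 : ∀ {row used p q} → Reachable 0 row used p q → p < 2
    pending<2 {p = zero} ρ = s≤s z≤n
    pending<2 {p = suc zero} ρ = s≤s (s≤s z≤n)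
    pending<2 {row} {p = suc (suc p)} ρ = ⊥-elim (ℕ.<-irrefl refl (ℕ.<-≤-trans row+p<row (ℕ.m≤m+n row p)))
      where
        row+p<row : row + p < row
        row+p<row = subst (row + p <_) (trans (sym (rows-left (partial ρ))) (ℕ.+-identityʳ row))
                          (All.lookup (bounded (partial ρ)) (Used⇒used ρ (inj₂ (inj₁ (2+[r+p]≡r+[2+p] row p)))))

    completions-last : ∀ {row used p q} → Reachable 0 row used p q → completions 0 row used ≡ pathPairs (suc ℓ) 0 p q
    completions-last ρ with pending<2 ρ | pending<2 (Reachable-swap ρ)
    completions-last {p = zero} {zero} ρ | _ | _ = ⊥-elim (p≢q ρ refl)
    completions-last {p = zero} {suc zero} ρ | _ | _ = refl
    completions-last {p = suc zero} {zero} ρ | _ | _ = refl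
    completions-last {p = suc zero} {suc zero} ρ | _ | _ = ⊥-elim (p≢q ρ refl)
    completions-last {q = suc (suc _)} ρ | _ | s≤s (s≤s ())
    completions-last {p = suc (suc _)} ρ | s≤s (s≤s ()) | _

    first-row-pending : ∀ {k used q} → Reachable k 0 used 0 (suc q) → q ≡ 0
    first-row-pending {q = zero} ρ = refl
    first-row-pending {used = used} {q = suc q} ρ with Used⇒used ρ {q} (inj₂ (inj₂ refl)) | size (partial ρ)
    ... | j∈used | length≡0 = ⊥-elim (nonempty used j∈used length≡0)
      where nonempty : ∀ (xs : List ℕ) {x} → x ∈ xs → length xs ≢ 0
            nonempty (_ ∷ _) _ ()

    Reachable-∷ : ∀ {k row used p q x p′ q′} → Reachable (suc k) row used p q → x < n → x ∉ used →
                  (∀ {j} → Used (suc row) p′ q′ j ⇔ (j ≡ x ⊎ Used row p q j)) → p′ ≢ q′ →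
                  (suc row < 2 → p′ ≡ 0 ⊎ q′ ≡ 0) → Reachable k (suc row) (x ∷ used) p′ q′
    Reachable-∷ ρ x<n x∉used Used⇔ p′≢q′ early = record
      { partial = Partial-∷ (partial ρ) x<n x∉used
      ; used⇒Used = λ { (here refl) → Equivalence.from Used⇔ (inj₁ refl)
                      ; (there j∈used) → Equivalence.from Used⇔ (inj₂ (used⇒Used ρ j∈used)) }
      ; Used⇒used = λ u → [ here , there ∘ Used⇒used ρ ]′ (Equivalence.to Used⇔ u)
      ; p≢q = p′≢q′
      ; early-row = early
      }

    Used-forward : ∀ {row r q j} → Used (suc row) (suc r) q j ⇔ (j ≡ row + r ⊎ Used row 0 (suc q) j)
    Used-forward {row} {r} {q} {j} = mk⇔ to from
      where
        to : Used (suc row) (suc r) q j → j ≡ row + r ⊎ Used row 0 (suc q) j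
        to (inj₁ (s≤s 2+j≤row)) with ℕ.m≤n⇒m<n∨m≡n 2+j≤row
        ... | inj₁ 2+j<row = inj₂ (inj₁ 2+j<row)
        ... | inj₂ 2+j≡row = inj₂ (inj₂ (inj₁ (trans 2+j≡row (sym (ℕ.+-identityʳ row)))))
        to (inj₂ (inj₁ eq)) = inj₁ (ℕ.suc-injective (ℕ.suc-injective (trans eq (cong suc (ℕ.+-suc row r)))))
        to (inj₂ (inj₂ eq)) = inj₂ (inj₂ (inj₂ (trans eq (sym (ℕ.+-suc row q)))))
        from : j ≡ row + r ⊎ Used row 0 (suc q) j → Used (suc row) (suc r) q j
        from (inj₁ refl) = inj₂ (inj₁ (cong suc (sym (ℕ.+-suc row r))))
        from (inj₂ (inj₁ 2+j<row)) = inj₁ (ℕ.m<n⇒m<1+n 2+j<row)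
        from (inj₂ (inj₂ (inj₁ eq))) = inj₁ (s≤s (ℕ.≤-reflexive (trans eq (ℕ.+-identityʳ row))))
        from (inj₂ (inj₂ (inj₂ eq))) = inj₂ (inj₂ (trans eq (ℕ.+-suc row q)))

    Used-backward : ∀ {o p q j} → Used (3 + o) p q j ⇔ (j ≡ o ⊎ Used (2 + o) (suc p) (suc q) j)
    Used-backward {o} {p} {q} {j} = mk⇔ to from
      where
        to : Used (3 + o) p q j → j ≡ o ⊎ Used (2 + o) (suc p) (suc q) j
        to (inj₁ (s≤s 2+j≤2+o)) with ℕ.m≤n⇒m<n∨m≡n 2+j≤2+o
        ... | inj₁ 2+j<2+o = inj₂ (inj₁ 2+j<2+o)
        ... | inj₂ 2+j≡2+o = inj₁ (ℕ.suc-injective (ℕ.suc-injective 2+j≡2+o))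
        to (inj₂ (inj₁ eq)) = inj₂ (inj₂ (inj₁ (trans eq (cong (suc ∘ suc) (sym (ℕ.+-suc o p))))))
        to (inj₂ (inj₂ eq)) = inj₂ (inj₂ (inj₂ (trans eq (cong (suc ∘ suc) (sym (ℕ.+-suc o q))))))
        from : j ≡ o ⊎ Used (2 + o) (suc p) (suc q) j → Used (3 + o) p q j
        from (inj₁ refl) = inj₁ ℕ.≤-refl
        from (inj₂ (inj₁ 2+j<2+o)) = inj₁ (ℕ.m<n⇒m<1+n 2+j<2+o)
        from (inj₂ (inj₂ (inj₁ eq))) = inj₂ (inj₁ (trans eq (cong (suc ∘ suc) (ℕ.+-suc o p))))
        from (inj₂ (inj₂ (inj₂ eq))) = inj₂ (inj₂ (trans eq (cong (suc ∘ suc) (ℕ.+-suc o q))))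

    Completes : ℕ → Set
    Completes k = ∀ {row used p q} → Reachable k row used p q → completions k row used ≡ pathPairs (suc ℓ) k p q

    backward-taken : ∀ k row used → (∀ {j} → 2 + j ≡ row → j ∈ used) → backward k row used ≡ 0
    backward-taken k zero used _ = refl
    backward-taken k (suc zero) used _ = refl
    backward-taken k (suc (suc r)) used taken
      rewrite 𝟙-no (¬? (r ∈? used)) (λ r∉used → r∉used (taken refl)) = ℕ.*-zeroʳ (𝟙 (r <? n))

    choice-stranding : ∀ {k row used j x} → Partial (suc k) row used → j ∉ used → 2 + j ≡ row → row ≤ x →
                       choice k row used x ≡ 0
    choice-stranding {k} {row} {used} {j} {x} π j∉used refl row≤x with x <? n
    ... | no _ = refl
    ... | yes x<n with x ∈? used
    ...   | yes _ = refl
    ...   | no x∉used = cong (λ c → (c + 0) + 0) (completions-missing (Partial-∷ π x<n x∉used) j∉x∷used ℕ.≤-refl)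
      where
        j∉x∷used : j ∉ x ∷ used
        j∉x∷used (here refl) = ℕ.<-irrefl refl (ℕ.<-≤-trans (ℕ.m<n+m j (s≤s z≤n)) row≤x)
        j∉x∷used (there j∈used) = j∉used j∈used

    forward-pending : ∀ {row r q} → Used row 0 (suc q) (row + r) → suc r ≡ q
    forward-pending {row} {r} (inj₁ 2+x<row) = ⊥-elim (ℕ.<-asym 2+x<row (s≤s (ℕ.m≤n⇒m≤1+n (ℕ.m≤m+n row r))))
    forward-pending {row} {r} (inj₂ (inj₁ eq)) =
      ⊥-elim (ℕ.<-irrefl (sym (trans eq (ℕ.+-identityʳ row))) (s≤s (ℕ.m≤n⇒m≤1+n (ℕ.m≤m+n row r))))
    forward-pending {row} {r} (inj₂ (inj₂ eq)) =
      ℕ.suc-injective (ℕ.+-cancelˡ-≡ row _ _ (trans (sym (2+[r+p]≡r+[2+p] row r)) eq))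

    forward-early : ∀ {k row used q} → Reachable k row used 0 (suc q) → suc row < 2 → q ≡ 0
    forward-early {row = zero} ρ _ = first-row-pending ρ
    forward-early {row = suc _} ρ (s≤s (s≤s ()))

    forward-taken : ∀ {k row used r} → Reachable k row used 0 (suc (suc r)) → row + r ∈ used
    forward-taken {row = row} {r = r} ρ = Used⇒used ρ (inj₂ (inj₂ (2+[r+p]≡r+[2+p] row r)))

    forward-fresh : ∀ {k row used r q} → Reachable k row used 0 (suc q) → suc r ≢ q → row + r ∉ used
    forward-fresh ρ 1+r≢q = 1+r≢q ∘ forward-pending ∘ used⇒Used ρ

    choice-forward : ∀ {k row used q} → Reachable (suc k) row used 0 (suc q) → Completes k → ∀ r →
                     choice k row used (row + r) ≡ 𝟙 (¬? (suc r ≟ q)) * pathPairs (suc ℓ) k (suc r) q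
    choice-forward {k} {row} {used} {q} ρ completes r with suc r ≟ q
    ... | yes refl rewrite 𝟙-no (¬? ((row + r) ∈? used)) (λ x∉used → x∉used (forward-taken ρ)) =
      ℕ.*-zeroʳ (𝟙 (row + r <? n))
    ... | no 1+r≢q with row + r <? n
    ...   | no x≮n = sym (trans (ℕ.*-identityˡ _) (pathPairs-far (suc ℓ) k (suc r) q (s≤s 1+k≤r)))
      where
        1+k≤r : suc k ≤ r
        1+k≤r = ℕ.+-cancelˡ-≤ row (suc k) r (ℕ.≤-trans (ℕ.≤-reflexive (rows-left (partial ρ))) (ℕ.≮⇒≥ x≮n))
    ...   | yes x<n rewrite 𝟙-yes (¬? ((row + r) ∈? used)) (forward-fresh ρ 1+r≢q) =
      cong (_+ 0) (trans (ℕ.*-identityˡ _)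
        (completes (Reachable-∷ ρ x<n (forward-fresh ρ 1+r≢q) Used-forward 1+r≢q (inj₂ ∘ forward-early ρ))))

    completions-forward : ∀ {k row used q} → Reachable (suc k) row used 0 (suc q) → Completes k →
                          completions (suc k) row used ≡ pathPairs (suc ℓ) (suc k) 0 (suc q)
    completions-forward {k} {row} {used} {q} ρ completes = begin
      completions (suc k) row used
        ≡⟨ completions-choices k row used ⟩
      backward k row used + (choice k row used (row + ℓ) + choice k row used (row + suc ℓ))
        ≡⟨ cong₂ _+_ (backward-taken k row used (λ eq → Used⇒used ρ (inj₂ (inj₁ (trans eq (sym (ℕ.+-identityʳ row)))))))
                     (cong₂ _+_ (choice-forward ρ completes ℓ) (choice-forward ρ completes (suc ℓ))) ⟩
      pathPairs (suc ℓ) (suc k) 0 (suc q)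
        ∎
      where open ≡-Reasoning

    backward-fresh : ∀ {o p q} → ¬ Used (2 + o) (suc p) (suc q) o
    backward-fresh (inj₁ 2+o<2+o) = ℕ.<-irrefl refl 2+o<2+o
    backward-fresh {o} {p} (inj₂ (inj₁ eq)) = ℕ.<-irrefl eq (ℕ.m<m+n (2 + o) (s≤s z≤n))
    backward-fresh {o} {q = q} (inj₂ (inj₂ eq)) = ℕ.<-irrefl eq (ℕ.m<m+n (2 + o) (s≤s z≤n))

    completions-backward : ∀ {k o used p q} → Reachable (suc k) (2 + o) used (suc p) (suc q) → Completes k →
                           completions (suc k) (2 + o) used ≡ pathPairs (suc ℓ) (suc k) (suc p) (suc q)
    completions-backward {k} {o} {used} {p} {q} ρ completes = begin
      completions (suc k) (2 + o) used
        ≡⟨ completions-choices k (2 + o) used ⟩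
      backward k (2 + o) used + (choice k (2 + o) used (2 + o + ℓ) + choice k (2 + o) used (2 + o + suc ℓ))
        ≡⟨ cong₂ _+_ backward-value (cong₂ _+_ (choice-stranding (partial ρ) o∉used refl (ℕ.m≤m+n (2 + o) ℓ))
                                               (choice-stranding (partial ρ) o∉used refl (ℕ.m≤m+n (2 + o) (suc ℓ)))) ⟩
      pathPairs (suc ℓ) k p q + 0
        ≡⟨ ℕ.+-identityʳ _ ⟩
      pathPairs (suc ℓ) k p q
        ∎
      where
        open ≡-Reasoning
        o∉used : o ∉ used
        o∉used = backward-fresh ∘ used⇒Used ρ
        o<n : o < n
        o<n = ℕ.<-≤-trans (ℕ.m<n+m o (s≤s z≤n)) (subst (2 + o ≤_) (rows-left (partial ρ)) (ℕ.m≤m+n (2 + o) (suc k)))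
        backward-value : backward k (2 + o) used ≡ pathPairs (suc ℓ) k p q
        backward-value rewrite 𝟙-yes (o <? n) o<n | 𝟙-yes (¬? (o ∈? used)) o∉used =
          trans (ℕ.*-identityˡ _) (trans (ℕ.*-identityˡ _)
            (completes (Reachable-∷ ρ o<n o∉used Used-backward (p≢q ρ ∘ cong suc) (λ { (s≤s (s≤s ())) }))))

    completions≡pathPairs : ∀ k → Completes k
    completions≡pathPairs zero ρ = completions-last ρ
    completions≡pathPairs (suc k) {p = zero} {zero} ρ = ⊥-elim (p≢q ρ refl)
    completions≡pathPairs (suc k) {p = zero} {suc q} ρ = completions-forward ρ (completions≡pathPairs k)
    completions≡pathPairs (suc k) {p = suc p} {zero} ρ =
      trans (completions-forward (Reachable-swap ρ) (completions≡pathPairs k)) (pathPairs-sym (suc ℓ) (suc k) 0 (suc p))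
    completions≡pathPairs (suc k) {row = zero} {p = suc p} {suc q} ρ with early-row ρ (s≤s z≤n)
    ... | inj₁ ()
    ... | inj₂ ()
    completions≡pathPairs (suc k) {row = suc zero} {p = suc p} {suc q} ρ with early-row ρ ℕ.≤-refl
    ... | inj₁ ()
    ... | inj₂ ()
    completions≡pathPairs (suc k) {row = suc (suc o)} {p = suc p} {suc q} ρ = completions-backward ρ (completions≡pathPairs k)

    P≡pathPairs : P n W ≡ pathPairs (suc ℓ) n 0 1
    P≡pathPairs = trans P≡completions (completions≡pathPairs n initial)
      where
        initial : Reachable n 0 [] 0 1
        initial = record
          { partial = record { rows-left = refl ; unique = [] ; bounded = [] ; size = refl }
          ; used⇒Used = λ ()
          ; Used⇒used = λ { (inj₁ ()) ; (inj₂ (inj₁ ())) ; (inj₂ (inj₂ ())) }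
          ; p≢q = λ ()
          ; early-row = λ _ → inj₁ refl
          }

  module RecurrentSequence (m : ℕ) (1≤m : 1 ≤ m) (s : ℤ → ℕ)
    (s-negative : ∀ (n : ℤ) → n ℤ.< + 0 → s n ≡ 0)
    (s-rec : ∀ (n : ℕ) → s (+ n) ≡ δ n 0 + s (+ n - + (m + 1)) + s (+ n - + (m + 2)))
    where

    t : ℕ → ℕ → ℕ
    t N p = s (+ N - + p)

    t-future : ∀ N p → N < p → t N p ≡ 0
    t-future N p N<p = s-negative (+ N - + p) (m<n⇒m-n<0 N<p)

    t-start : t 0 0 ≡ 1
    t-start = trans (s-rec 0) (cong₂ _+_ (cong suc (t-future 0 (m + 1) (ℕ.<-≤-trans 1≤m (ℕ.m≤m+n m 1))))
                                         (t-future 0 (m + 2) (ℕ.<-≤-trans 1≤m (ℕ.m≤m+n m 2))))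

    t-rec : ∀ N → t (suc N) 0 ≡ t (suc N) (suc m) + t (suc N) (suc (suc m))
    t-rec N = begin
      s (+ suc N - + 0)                                      ≡⟨ cong s (ℤ.+-identityʳ (+ suc N)) ⟩
      s (+ suc N)                                            ≡⟨ s-rec (suc N) ⟩
      s (+ suc N - + (m + 1)) + s (+ suc N - + (m + 2))      ≡⟨ cong₂ _+_ (cong (t (suc N)) (ℕ.+-comm m 1)) (cong (t (suc N)) (ℕ.+-comm m 2)) ⟩
      s (+ suc N - + suc m) + s (+ suc N - + suc (suc m))    ∎
      where open ≡-Reasoning

    open ProductFormula m 1≤m t (λ N p → cong s ([1+m]-[1+n]≡m-n N p)) t-future t-start t-rec using (product-formula)

    s-product-formula : ∀ n → s (+ n - + (m + 1)) * s (+ n - + (m + 2))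
                              ≡ sum< n (λ i → pathPairs m i 0 1 * s (+ n - + (2 * m + 3 + i)) ^ 2)
    s-product-formula n =
      trans (cong₂ _*_ (cong (t n) (ℕ.+-comm m 1)) (cong (t n) (ℕ.+-comm m 2))) (product-formula n)

    start-or-vanishing : ∀ n → δ n 0 ≡ 0 ⊎ (δ n 0 ≡ 1 × s (+ n - + (m + 1)) ≡ 0 × s (+ n - + (m + 2)) ≡ 0)
    start-or-vanishing zero = inj₂ (refl , t-future 0 (m + 1) (ℕ.<-≤-trans 1≤m (ℕ.m≤m+n m 1))
                                         , t-future 0 (m + 2) (ℕ.<-≤-trans 1≤m (ℕ.m≤m+n m 2)))
    start-or-vanishing (suc n) = inj₁ refl

  square-of-sum : ∀ d a b → d ≡ 0 ⊎ (d ≡ 1 × a ≡ 0 × b ≡ 0) → (d + a + b) ^ 2 ≡ d + a ^ 2 + b ^ 2 + 2 * (a * b)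
  square-of-sum d a b (inj₁ refl) =
    solve 2 (λ a b → (con 0 :+ a :+ b) :* ((con 0 :+ a :+ b) :* con 1)
                     := con 0 :+ a :* (a :* con 1) :+ b :* (b :* con 1) :+ con 2 :* (a :* b)) refl a b
  square-of-sum d a b (inj₂ (refl , refl , refl)) = refl

  Σ[to]≡sum< : ∀ {c} n (f : ℕ → ℕ) → 1 ≤ c → (∀ i → n < c + i → f (c + i) ≡ 0) →
               Σ[ c to n ] f ≡ sum< n (λ i → f (c + i))
  Σ[to]≡sum< {c} n f 1≤c vanishing = begin
    sum (map (λ i → f (c + i)) (upTo K))          ≡⟨ cong sum (List.map-upTo (λ i → f (c + i)) K) ⟩
    sum (applyUpTo (λ i → f (c + i)) K)           ≡⟨ sum-applyUpTo K (λ i → f (c + i)) ⟩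
    sum< K (λ i → f (c + i))                      ≡⟨ sym (sum<-vanishing-tail K (n ∸ K) _ tail) ⟩
    sum< (K + (n ∸ K)) (λ i → f (c + i))          ≡⟨ cong (λ k → sum< k (λ i → f (c + i))) (ℕ.m+[n∸m]≡n K≤n) ⟩
    sum< n (λ i → f (c + i))                      ∎
    where
      open ≡-Reasoning
      K : ℕ
      K = suc n ∸ c
      K≤n : K ≤ n
      K≤n = ℕ.∸-monoʳ-≤ (suc n) 1≤c
      tail : ∀ i → K ≤ i → f (c + i) ≡ 0
      tail i K≤i = vanishing i (ℕ.≤-trans (ℕ.m≤n+m∸n (suc n) c) (ℕ.+-monoʳ-≤ c K≤i))

open import Defs
open import Data.Nat using (ℕ; suc; _+_; _*_; _^_; _∸_; _≤_; z≤n; s≤s)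
import Data.Nat as ℕ
import Data.Nat.Properties as ℕ
open import Data.Integer using (ℤ; +_; -[1+_]; _-_; _<_)
open import Data.List using (_∷_; [])
open import Relation.Binary.PropositionalEquality using (_≡_; sym; trans; cong; module ≡-Reasoning)
open Lemmas

mainTheorem11 : (m : ℕ) → 1 ≤ m → (s : ℤ → ℕ)
    → (∀ (n : ℤ) → n < + 0 → s n ≡ 0)
    → (∀ (n : ℕ) → s (+ n) ≡ δ n 0 + s (+ n - + (m + 1)) + s (+ n - + (m + 2)))
    → ∀ (n : ℕ) → s (+ n) ^ 2 ≡ δ n 0 + s (+ n - + (m + 1)) ^ 2 + s (+ n - + (m + 2)) ^ 2
    + 2 * Σ[ 2 * m + 3 to n ] (λ l → P (l ∸ (2 * m + 3)) (-[1+ 1 ] ∷ (+ m - + 1) ∷ + m ∷ []) * s (+ n - + l) ^ 2)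
mainTheorem11 m@(suc ℓ) 1≤m s s-negative s-rec n = begin
    s (+ n) ^ 2                                      ≡⟨ cong (_^ 2) (s-rec n) ⟩
    (δ n 0 + a + b) ^ 2                              ≡⟨ square-of-sum (δ n 0) a b (start-or-vanishing n) ⟩
    δ n 0 + a ^ 2 + b ^ 2 + 2 * (a * b)              ≡⟨ cong (λ x → δ n 0 + a ^ 2 + b ^ 2 + 2 * x) (sym squares) ⟩
    δ n 0 + a ^ 2 + b ^ 2 + 2 * Σ[ c to n ] summand  ∎
  where
    open ≡-Reasoning
    open RecurrentSequence m 1≤m s s-negative s-rec
    a b c : ℕ
    a = s (+ n - + (m + 1))
    b = s (+ n - + (m + 2))
    c = 2 * m + 3
    summand : ℕ → ℕ
    summand l = P (l ∸ c) (displacements ℓ) * s (+ n - + l) ^ 2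
    summand-beyond : ∀ i → n ℕ.< c + i → summand (c + i) ≡ 0
    summand-beyond i n<c+i rewrite s-negative _ (m<n⇒m-n<0 n<c+i) = ℕ.*-zeroʳ (P (c + i ∸ c) (displacements ℓ))
    summand-count : ∀ i → summand (c + i) ≡ pathPairs m i 0 1 * s (+ n - + (c + i)) ^ 2
    summand-count i rewrite ℕ.m+n∸m≡n c i = cong (_* s (+ n - + (c + i)) ^ 2) (PermutationCount.P≡pathPairs i ℓ)
    squares : Σ[ c to n ] summand ≡ a * b
    squares = trans (Σ[to]≡sum< n summand (s≤s z≤n) summand-beyond)
                    (trans (sum<-cong n (λ i _ → summand-count i)) (sym (s-product-formula n)))
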